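{- Let $y_n(x)=\sum_{k=0}^n\frac{(n+k)!}{(n-k)!\,k!}\left(\frac{x}{2}\right)^k$ for $n\ge 0$ be the Bessel polynomials, and set $y_{ -1}(x)=1$. Then for all $n\geq 0$, $$y_n(x)=\sum_{k=0}^n(2n-2k-1)!!\binom{n}{k}y_{k-1}(x)\,x^{n-k}.$$
   Context: Double factorials: $(2m-1)!!=1\cdot 3\cdots(2m-1)$ for $m\ge1$, with the convention $(-1)!!=1$. -}

module Defs where

open import Data.Nat as ℕ using (ℕ; zero; suc; _∸_; NonZero)
open import Data.Nat.Properties using (_!≢0; m*n≢0)
open import Data.Nat.Combinatorics using (_C_)
open import Data.Nat using (_!)
open import Data.Integer using (+_)
open import Data.Rational using (ℚ; _/_; _+_; _*_; 0ℚ; 1ℚ)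

_^ℚ_ : ℚ → ℕ → ℚ
x ^ℚ zero  = 1ℚ
x ^ℚ suc k = x * (x ^ℚ k)

sumTo : ℕ → (ℕ → ℚ) → ℚ
sumTo zero    f = f 0
sumTo (suc n) f = sumTo n f + f (suc n)

ℕtoℚ : ℕ → ℚ
ℕtoℚ n = (+ n) / 1

-- dfact m = (2m-1)!!, with dfact 0 = (-1)!! = 1
dfact : ℕ → ℕ
dfact zero    = 1
dfact (suc m) = suc (2 ℕ.* m) ℕ.* dfact m

besselCoeff : ℕ → ℕ → ℚ
besselCoeff n k = ((+ ((n ℕ.+ k) !)) / ((n ∸ k) ! ℕ.* k !))
  {{m*n≢0 ((n ∸ k) !) (k !) {{(n ∸ k) !≢0}} {{k !≢0}}}}

½ : ℚ
½ = (+ 1) / 2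

y : ℕ → ℚ → ℚ
y n x = sumTo n (λ k → besselCoeff n k * ((x * ½) ^ℚ k))

-- yPrev k x = y_{k-1}(x), with y_{-1}(x) = 1
yPrev : ℕ → ℚ → ℚ
yPrev zero    x = 1ℚ
yPrev (suc k) x = y k x

module Submission where

-- Put f_k = y_{k−1}(x) and g_m = (2m−1)!!·x^m.  The right-hand side of the
-- theorem is the binomial convolution (g ⋆ f)_n = Σ_k C(n,k)·g_{n−k}·f_k, and
-- y_n(x) = f_{n+1}.  Both sequences satisfy the Bessel recurrence
--   u_{n+2} = (2n+3)·x·u_{n+1} + u_n
-- and agree for n = 0, 1, hence everywhere (recurrence-unique).
--  * For y_n the recurrence is read off the monomial form
--    y_n(x) = Σ_k C(n+k,2k)·(2k−1)!!·x^k, whose integer coefficients satisfy a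
--    Pascal-type recurrence (module BinomialIdentities, then yMonomial-rec).
--  * For g ⋆ f it follows from a small calculus of binomial convolutions, i.e.
--    of products of exponential generating functions: Leibniz rules for the
--    shift ∂ (= d/dt) and the Euler operator θ (= t·d/dt), and θa ⋆ ∂b = ∂a ⋆ θb,
--    applied to (1−2xt)G′ = xG and (1−2xt)F″ = xF′ + F (conv-rec).

open import Defs
open import Data.Nat using (ℕ; zero; suc; _∸_; _≤_; _<_; z≤n; s≤s; NonZero)
import Data.Nat as ℕ
open import Data.Product using (_×_; _,_; proj₁)
open import Data.Nat.Combinatorics using (_C_; nCk+nC[k+1]≡[n+1]C[k+1]; k>n⇒nCk≡0)
open import Relation.Binary.PropositionalEquality

module BinomialIdentities where
  open import Data.Nat using (_+_; _*_; _^_; _!; _≤?_; _<?_)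
  open import Data.Nat.Properties
  open import Data.Nat.Combinatorics using (nCk≡n!/k![n-k]!; k![n∸k]!∣n!; [n-k]*[n-k-1]!≡[n-k]!)
  open import Data.Nat.DivMod using (_/_; m/n*n≡m)
  open import Data.Nat.Solver using (module +-*-Solver)
  open import Relation.Nullary using (yes; no)
  open +-*-Solver

  factorial-split : ∀ {n k} → k ≤ n → n ! ≡ (n C k) * (k ! * (n ∸ k) !)
  factorial-split {n} {k} k≤n = sym (begin
      (n C k) * (k ! * (n ∸ k) !)
    ≡⟨ cong (_* (k ! * (n ∸ k) !)) (nCk≡n!/k![n-k]! k≤n) ⟩
      (n ! / (k ! * (n ∸ k) !)) * (k ! * (n ∸ k) !)
    ≡⟨ m/n*n≡m (k![n∸k]!∣n! k≤n) ⟩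
      n !
    ∎)
    where
    open ≡-Reasoning
    instance _ = k !* (n ∸ k) !≢0

  -- Absorption: C(n,k)·(n−k) = C(n,k+1)·(k+1).  For k < n both sides,
  -- multiplied by k!·(n−k−1)!, equal n!; otherwise both sides vanish.
  binom-absorb : ∀ n k → (n C k) * (n ∸ k) ≡ (n C suc k) * suc k
  binom-absorb n k with k <? n
  ... | yes k<n = *-cancelʳ-≡ _ _ (k ! * (n ∸ suc k) !) {{k !* (n ∸ suc k) !≢0}} (begin
      (n C k) * (n ∸ k) * (k ! * (n ∸ suc k) !)
    ≡⟨ solve 4 (λ c d f g → c :* d :* (f :* g) := c :* (f :* (d :* g))) refl (n C k) (n ∸ k) (k !) ((n ∸ suc k) !) ⟩
      (n C k) * (k ! * ((n ∸ k) * (n ∸ suc k) !))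
    ≡⟨ cong (λ z → (n C k) * (k ! * z)) ([n-k]*[n-k-1]!≡[n-k]! k<n) ⟩
      (n C k) * (k ! * (n ∸ k) !)
    ≡⟨ sym (factorial-split (<⇒≤ k<n)) ⟩
      n !
    ≡⟨ factorial-split k<n ⟩
      (n C suc k) * (suc k * k ! * (n ∸ suc k) !)
    ≡⟨ solve 4 (λ c s f g → c :* (s :* f :* g) := c :* s :* (f :* g)) refl (n C suc k) (suc k) (k !) ((n ∸ suc k) !) ⟩
      (n C suc k) * suc k * (k ! * (n ∸ suc k) !)
    ∎)
    where open ≡-Reasoning
  ... | no k≮n = begin
      (n C k) * (n ∸ k)
    ≡⟨ cong ((n C k) *_) (m≤n⇒m∸n≡0 (≮⇒≥ k≮n)) ⟩
      (n C k) * 0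
    ≡⟨ *-zeroʳ (n C k) ⟩
      0
    ≡⟨ cong (_* suc k) (k>n⇒nCk≡0 (s≤s (≮⇒≥ k≮n))) ⟨
      (n C suc k) * suc k
    ∎
    where open ≡-Reasoning

  even-factorial : ∀ k → (2 * k) ! ≡ dfact k * 2 ^ k * k !
  even-factorial zero = refl
  even-factorial (suc k) = begin
      (2 * suc k) !
    ≡⟨ cong _! (*-suc 2 k) ⟩
      (2 + 2 * k) !
    ≡⟨ cong (λ z → (2 + 2 * k) * ((1 + 2 * k) * z)) (even-factorial k) ⟩
      (2 + 2 * k) * ((1 + 2 * k) * (dfact k * 2 ^ k * k !))
    ≡⟨ solve 4 (λ k d t f → (con 2 :+ con 2 :* k) :* ((con 1 :+ con 2 :* k) :* (d :* t :* f))
                := (con 1 :+ con 2 :* k) :* d :* (con 2 :* t) :* ((con 1 :+ k) :* f)) refl k (dfact k) (2 ^ k) (k !) ⟩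
      dfact (suc k) * 2 ^ suc k * suc k !
    ∎
    where open ≡-Reasoning

  -- Pascal's rule applied twice, with the middle coefficient absorbed:
  -- C(N+2,j+2)·(j+1) = C(N,j)·(j+1+2(N−j)) + C(N,j+2)·(j+1).
  pascal-twice : ∀ N j →
    (suc (suc N) C suc (suc j)) * suc j ≡ (N C j) * (suc j + 2 * (N ∸ j)) + (N C suc (suc j)) * suc j
  pascal-twice N j = begin
      (suc (suc N) C suc (suc j)) * suc j
    ≡⟨ cong (_* suc j) (sym (trans (cong₂ _+_ (nCk+nC[k+1]≡[n+1]C[k+1] N j) (nCk+nC[k+1]≡[n+1]C[k+1] N (suc j)))
                                     (nCk+nC[k+1]≡[n+1]C[k+1] (suc N) (suc j)))) ⟩
      ((N C j) + (N C suc j) + ((N C suc j) + (N C suc (suc j)))) * suc j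
    ≡⟨ solve 4 (λ a b c s → (a :+ b :+ (b :+ c)) :* s := a :* s :+ con 2 :* (b :* s) :+ c :* s) refl
         (N C j) (N C suc j) (N C suc (suc j)) (suc j) ⟩
      (N C j) * suc j + 2 * ((N C suc j) * suc j) + (N C suc (suc j)) * suc j
    ≡⟨ cong (λ z → (N C j) * suc j + 2 * z + (N C suc (suc j)) * suc j) (sym (binom-absorb N j)) ⟩
      (N C j) * suc j + 2 * ((N C j) * (N ∸ j)) + (N C suc (suc j)) * suc j
    ≡⟨ solve 4 (λ a s d c → a :* s :+ con 2 :* (a :* d) :+ c :* s := a :* (s :+ con 2 :* d) :+ c :* s) refl
         (N C j) (suc j) (N ∸ j) (N C suc (suc j)) ⟩
      (N C j) * (suc j + 2 * (N ∸ j)) + (N C suc (suc j)) * suc j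
    ∎
    where open ≡-Reasoning

  binom-weight-cong : ∀ n j {a b} → (j ≤ n → a ≡ b) → (n C j) * a ≡ (n C j) * b
  binom-weight-cong n j {a} {b} eq with j ≤? n
  ... | yes j≤n = cong ((n C j) *_) (eq j≤n)
  ... | no j≰n = trans (cong (_* a) C≡0) (sym (cong (_* b) C≡0))
    where C≡0 = k>n⇒nCk≡0 (≰⇒> j≰n)

  -- Integer coefficients of the Bessel polynomial in the monomial basis:
  -- y_n(x) = Σ_k C(n+k,2k)·(2k−1)!!·x^k.
  besselℕ : ℕ → ℕ → ℕ
  besselℕ n k = ((n + k) C (2 * k)) * dfact k

  -- `2 * k` unfolds to `k + (k + 0)`
  2*k≡k+k : ∀ k → 2 * k ≡ k + k
  2*k≡k+k k = cong (k +_) (+-identityʳ k)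

  -- y_n has degree n: C(n+k,2k) = 0 once 2k > n+k.
  besselℕ-vanishes : ∀ {n k} → n < k → besselℕ n k ≡ 0
  besselℕ-vanishes {n} {k} n<k =
    cong (_* dfact k) (k>n⇒nCk≡0 (subst (n + k <_) (sym (2*k≡k+k k)) (+-monoˡ-< k n<k)))

  -- The defining quotient (n+k)!/((n−k)!·k!) equals C(n+k,2k)·(2k−1)!!·2^k.
  bessel-factorials : ∀ {n k} → k ≤ n → (n + k) ! ≡ besselℕ n k * 2 ^ k * ((n ∸ k) ! * k !)
  bessel-factorials {n} {k} k≤n = begin
      (n + k) !
    ≡⟨ factorial-split 2k≤n+k ⟩
      ((n + k) C (2 * k)) * ((2 * k) ! * ((n + k) ∸ 2 * k) !)
    ≡⟨ cong₂ (λ u v → ((n + k) C (2 * k)) * (u * v !)) (even-factorial k) gap ⟩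
      ((n + k) C (2 * k)) * (dfact k * 2 ^ k * k ! * (n ∸ k) !)
    ≡⟨ solve 5 (λ c d t f g → c :* (d :* t :* f :* g) := c :* d :* t :* (g :* f)) refl
         ((n + k) C (2 * k)) (dfact k) (2 ^ k) (k !) ((n ∸ k) !) ⟩
      besselℕ n k * 2 ^ k * ((n ∸ k) ! * k !)
    ∎
    where
    open ≡-Reasoning
    2k≤n+k : 2 * k ≤ n + k
    2k≤n+k = subst (_≤ n + k) (sym (2*k≡k+k k)) (+-monoˡ-≤ k k≤n)
    gap : (n + k) ∸ 2 * k ≡ n ∸ k
    gap = begin
        (n + k) ∸ 2 * k    ≡⟨ cong₂ _∸_ (+-comm n k) (2*k≡k+k k) ⟩
        (k + n) ∸ (k + k)  ≡⟨ [m+n]∸[m+o]≡n∸o k n k ⟩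
        n ∸ k              ∎

  -- Coefficientwise form of the three-term recurrence y_{m+2} = (2m+3)·x·y_{m+1} + y_m.
  besselℕ-rec : ∀ m k →
    besselℕ (suc (suc m)) (suc k) ≡ suc (2 * suc m) * besselℕ (suc m) k + besselℕ m (suc k)
  besselℕ-rec m k = begin
      besselℕ (suc (suc m)) (suc k)
    ≡⟨ cong (λ i → (suc (suc N) C i) * dfact (suc k)) 2[1+k] ⟩
      (suc (suc N) C suc (suc j)) * (suc j * d)
    ≡⟨ sym (*-assoc (suc (suc N) C suc (suc j)) (suc j) d) ⟩
      (suc (suc N) C suc (suc j)) * suc j * d
    ≡⟨ cong (_* d) (pascal-twice N j) ⟩
      ((N C j) * (suc j + 2 * (N ∸ j)) + (N C suc (suc j)) * suc j) * d
    ≡⟨ cong (λ z → (z + (N C suc (suc j)) * suc j) * d) (binom-weight-cong N j weight) ⟩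
      ((N C j) * suc (2 * suc m) + (N C suc (suc j)) * suc j) * d
    ≡⟨ solve 5 (λ a w b s d → (a :* w :+ b :* s) :* d := w :* (a :* d) :+ b :* (s :* d)) refl
         (N C j) (suc (2 * suc m)) (N C suc (suc j)) (suc j) d ⟩
      suc (2 * suc m) * ((N C j) * d) + (N C suc (suc j)) * dfact (suc k)
    ≡⟨ cong₂ (λ u v → suc (2 * suc m) * ((u C j) * d) + (N C v) * dfact (suc k)) (+-suc m k) (sym 2[1+k]) ⟩
      suc (2 * suc m) * besselℕ (suc m) k + besselℕ m (suc k)
    ∎
    where
    open ≡-Reasoning
    N j d : ℕ
    N = m + suc k
    j = 2 * k
    d = dfact k
    2[1+k] : 2 * suc k ≡ suc (suc j)
    2[1+k] = *-suc 2 k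
    weight : j ≤ N → suc j + 2 * (N ∸ j) ≡ suc (2 * suc m)
    weight j≤N = +-cancelʳ-≡ j _ _ (begin
        suc j + 2 * (N ∸ j) + j
      ≡⟨ solve 2 (λ j g → con 1 :+ j :+ con 2 :* g :+ j := con 1 :+ con 2 :* (g :+ j)) refl j (N ∸ j) ⟩
        suc (2 * (N ∸ j + j))
      ≡⟨ cong (λ z → suc (2 * z)) (m∸n+n≡m j≤N) ⟩
        suc (2 * N)
      ≡⟨ solve 2 (λ m k → con 1 :+ con 2 :* (m :+ (con 1 :+ k)) := con 1 :+ con 2 :* (con 1 :+ m) :+ con 2 :* k) refl m k ⟩
        suc (2 * suc m) + j
      ∎)

open BinomialIdentities using (binom-absorb; besselℕ; besselℕ-vanishes; bessel-factorials; besselℕ-rec)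

import Data.Integer as ℤ
import Data.Integer.Properties as ZP
open import Data.Rational as ℚ using (ℚ; _+_; _*_; 0ℚ; 1ℚ; toℚᵘ)
open import Data.Rational.Properties using (toℚᵘ-injective; fromℚᵘ-cong; toℚᵘ-fromℚᵘ; toℚᵘ-homo-+; toℚᵘ-homo-*)
import Data.Rational.Properties as ℚP
import Data.Rational.Unnormalised as U
import Data.Rational.Unnormalised.Properties as UP
import Data.Nat.Properties as ℕP
open import Data.Rational.Solver using (module +-*-Solver)
open +-*-Solver

ℕtoℚᵘ : ∀ n → toℚᵘ (ℕtoℚ n) U.≃ U.mkℚᵘ (ℤ.+ n) 0
ℕtoℚᵘ n = toℚᵘ-fromℚᵘ (U.mkℚᵘ (ℤ.+ n) 0)

-- ℕtoℚ is a semiring homomorphism; on denominator-1 fractions this is the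
-- corresponding fact about ℕ → ℤ.
ℕtoℚ-+ : ∀ a b → ℕtoℚ (a ℕ.+ b) ≡ ℕtoℚ a + ℕtoℚ b
ℕtoℚ-+ a b = toℚᵘ-injective (UP.≃-trans (ℕtoℚᵘ (a ℕ.+ b)) (UP.≃-trans sum≃
  (UP.≃-sym (UP.≃-trans (toℚᵘ-homo-+ (ℕtoℚ a) (ℕtoℚ b)) (UP.+-cong (ℕtoℚᵘ a) (ℕtoℚᵘ b))))))
  where
  sum≃ : U.mkℚᵘ (ℤ.+ (a ℕ.+ b)) 0 U.≃ U.mkℚᵘ (ℤ.+ a) 0 U.+ U.mkℚᵘ (ℤ.+ b) 0
  sum≃ = U.*≡* (cong (ℤ._* ℤ.+ 1) (trans (ZP.pos-+ a b)
           (sym (cong₂ ℤ._+_ (ZP.*-identityʳ (ℤ.+ a)) (ZP.*-identityʳ (ℤ.+ b))))))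

ℕtoℚ-* : ∀ a b → ℕtoℚ (a ℕ.* b) ≡ ℕtoℚ a * ℕtoℚ b
ℕtoℚ-* a b = toℚᵘ-injective (UP.≃-trans (ℕtoℚᵘ (a ℕ.* b)) (UP.≃-trans product≃
  (UP.≃-sym (UP.≃-trans (toℚᵘ-homo-* (ℕtoℚ a) (ℕtoℚ b)) (UP.*-cong (ℕtoℚᵘ a) (ℕtoℚᵘ b))))))
  where
  product≃ : U.mkℚᵘ (ℤ.+ (a ℕ.* b)) 0 U.≃ U.mkℚᵘ (ℤ.+ a) 0 U.* U.mkℚᵘ (ℤ.+ b) 0
  product≃ = U.*≡* (cong (ℤ._* ℤ.+ 1) (ZP.pos-* a b))

ℕtoℚ-quotient : ∀ a q .{{_ : NonZero q}} → (ℤ.+ (a ℕ.* q)) ℚ./ q ≡ ℕtoℚ a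
ℕtoℚ-quotient a q@(suc q-1) = fromℚᵘ-cong {U.mkℚᵘ (ℤ.+ (a ℕ.* q)) q-1} {U.mkℚᵘ (ℤ.+ a) 0}
  (U.*≡* (trans (ZP.*-identityʳ (ℤ.+ (a ℕ.* q))) (ZP.pos-* a q)))

sumTo-cong : ∀ n {f g : ℕ → ℚ} → (∀ k → k ≤ n → f k ≡ g k) → sumTo n f ≡ sumTo n g
sumTo-cong zero    f≗g = f≗g 0 z≤n
sumTo-cong (suc n) f≗g = cong₂ _+_ (sumTo-cong n (λ k k≤n → f≗g k (ℕP.m≤n⇒m≤1+n k≤n))) (f≗g (suc n) ℕP.≤-refl)

sumTo-shift : ∀ n (f : ℕ → ℚ) → sumTo (suc n) f ≡ f 0 + sumTo n (λ k → f (suc k))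
sumTo-shift zero    f = refl
sumTo-shift (suc n) f = trans (cong (_+ f (suc (suc n))) (sumTo-shift n f))
  (ℚP.+-assoc (f 0) (sumTo n (λ k → f (suc k))) (f (suc (suc n))))

sumTo-+ : ∀ n (f g : ℕ → ℚ) → sumTo n (λ k → f k + g k) ≡ sumTo n f + sumTo n g
sumTo-+ zero    f g = refl
sumTo-+ (suc n) f g = trans (cong (_+ (f (suc n) + g (suc n))) (sumTo-+ n f g))
  (solve 4 (λ a b c d → (a :+ b) :+ (c :+ d) := (a :+ c) :+ (b :+ d)) refl
    (sumTo n f) (sumTo n g) (f (suc n)) (g (suc n)))

sumTo-* : ∀ n c (f : ℕ → ℚ) → sumTo n (λ k → c * f k) ≡ c * sumTo n f
sumTo-* zero    c f = refl
sumTo-* (suc n) c f = trans (cong (_+ (c * f (suc n))) (sumTo-* n c f))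
  (sym (ℚP.*-distribˡ-+ c (sumTo n f) (f (suc n))))

sumTo-pad : ∀ j n (f : ℕ → ℚ) → (∀ k → n < k → f k ≡ 0ℚ) → sumTo (j ℕ.+ n) f ≡ sumTo n f
sumTo-pad zero    n f f≡0 = refl
sumTo-pad (suc j) n f f≡0 = begin
    sumTo (j ℕ.+ n) f + f (suc (j ℕ.+ n))
  ≡⟨ cong₂ _+_ (sumTo-pad j n f f≡0) (f≡0 _ (s≤s (ℕP.m≤n+m n j))) ⟩
    sumTo n f + 0ℚ
  ≡⟨ ℚP.+-identityʳ (sumTo n f) ⟩
    sumTo n f
  ∎
  where open ≡-Reasoning

odd : ℕ → ℚ
odd m = ℕtoℚ (suc (2 ℕ.* m))

yMonomial : ℕ → ℚ → ℚ
yMonomial n x = sumTo n (λ k → ℕtoℚ (besselℕ n k) * x ^ℚ k)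

two-pow-half : ∀ x k → ℕtoℚ (2 ℕ.^ k) * (x * ½) ^ℚ k ≡ x ^ℚ k
two-pow-half x zero    = refl
two-pow-half x (suc k) = begin
    ℕtoℚ (2 ℕ.* 2 ℕ.^ k) * ((x * ½) * (x * ½) ^ℚ k)
  ≡⟨ cong (_* ((x * ½) * (x * ½) ^ℚ k)) (ℕtoℚ-* 2 (2 ℕ.^ k)) ⟩
    (ℕtoℚ 2 * ℕtoℚ (2 ℕ.^ k)) * ((x * ½) * (x * ½) ^ℚ k)
  ≡⟨ solve 3 (λ x t p → (con (ℕtoℚ 2) :* t) :* ((x :* con ½) :* p) := x :* (t :* p)) refl
       x (ℕtoℚ (2 ℕ.^ k)) ((x * ½) ^ℚ k) ⟩
    x * (ℕtoℚ (2 ℕ.^ k) * (x * ½) ^ℚ k)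
  ≡⟨ cong (x *_) (two-pow-half x k) ⟩
    x * x ^ℚ k
  ∎
  where open ≡-Reasoning

besselCoeff-closed : ∀ {n k} → k ≤ n → besselCoeff n k ≡ ℕtoℚ (besselℕ n k ℕ.* 2 ℕ.^ k)
besselCoeff-closed {n} {k} k≤n =
  trans (ℚP./-cong {{denominator≢0}} {{denominator≢0}} (cong ℤ.+_ (bessel-factorials k≤n)) refl)
        (ℕtoℚ-quotient (besselℕ n k ℕ.* 2 ℕ.^ k) ((n ∸ k) ℕ.! ℕ.* k ℕ.!) {{denominator≢0}})
  where
  denominator≢0 : NonZero ((n ∸ k) ℕ.! ℕ.* k ℕ.!)
  denominator≢0 = ℕP.m*n≢0 ((n ∸ k) ℕ.!) (k ℕ.!) {{(n ∸ k) ℕP.!≢0}} {{k ℕP.!≢0}}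

y-monomial : ∀ n x → y n x ≡ yMonomial n x
y-monomial n x = sumTo-cong n term
  where
  term : ∀ k → k ≤ n → besselCoeff n k * (x * ½) ^ℚ k ≡ ℕtoℚ (besselℕ n k) * x ^ℚ k
  term k k≤n = begin
      besselCoeff n k * (x * ½) ^ℚ k
    ≡⟨ cong (_* (x * ½) ^ℚ k) (trans (besselCoeff-closed k≤n) (ℕtoℚ-* (besselℕ n k) (2 ℕ.^ k))) ⟩
      (ℕtoℚ (besselℕ n k) * ℕtoℚ (2 ℕ.^ k)) * (x * ½) ^ℚ k
    ≡⟨ ℚP.*-assoc (ℕtoℚ (besselℕ n k)) (ℕtoℚ (2 ℕ.^ k)) ((x * ½) ^ℚ k) ⟩
      ℕtoℚ (besselℕ n k) * (ℕtoℚ (2 ℕ.^ k) * (x * ½) ^ℚ k)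
    ≡⟨ cong (ℕtoℚ (besselℕ n k) *_) (two-pow-half x k) ⟩
      ℕtoℚ (besselℕ n k) * x ^ℚ k
    ∎
    where open ≡-Reasoning

yMonomial-rec : ∀ m x → yMonomial (suc (suc m)) x ≡ odd (suc m) * x * yMonomial (suc m) x + yMonomial m x
yMonomial-rec m x = begin
    yMonomial (suc (suc m)) x
  ≡⟨ sumTo-shift (suc m) _ ⟩   -- the constant term is 1·x⁰
    1ℚ * 1ℚ + sumTo (suc m) (λ k → ℕtoℚ (besselℕ (suc (suc m)) (suc k)) * x ^ℚ suc k)
  ≡⟨ cong (λ s → 1ℚ * 1ℚ + s) (trans (sumTo-cong (suc m) (λ k _ → term k)) (sumTo-+ (suc m) _ _)) ⟩
    1ℚ * 1ℚ + (sumTo (suc m) (λ k → c * (ℕtoℚ (besselℕ (suc m) k) * x ^ℚ k)) + tail)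
  ≡⟨ cong (λ s → 1ℚ * 1ℚ + (s + tail)) (sumTo-* (suc m) c _) ⟩
    1ℚ * 1ℚ + (c * yMonomial (suc m) x + tail)
  ≡⟨ solve 3 (λ a b t → a :+ (b :+ t) := b :+ (a :+ t)) refl (1ℚ * 1ℚ) (c * yMonomial (suc m) x) tail ⟩
    c * yMonomial (suc m) x + (1ℚ * 1ℚ + tail)
  ≡⟨ cong (λ s → c * yMonomial (suc m) x + s) (sym (sumTo-shift (suc m) (λ k → ℕtoℚ (besselℕ m k) * x ^ℚ k))) ⟩
    c * yMonomial (suc m) x + sumTo (2 ℕ.+ m) (λ k → ℕtoℚ (besselℕ m k) * x ^ℚ k)
  ≡⟨ cong (λ s → c * yMonomial (suc m) x + s) (sumTo-pad 2 m _ beyond-degree) ⟩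
    c * yMonomial (suc m) x + yMonomial m x
  ∎
  where
  open ≡-Reasoning
  c tail : ℚ
  c = odd (suc m) * x
  tail = sumTo (suc m) (λ k → ℕtoℚ (besselℕ m (suc k)) * x ^ℚ suc k)
  term : ∀ k → ℕtoℚ (besselℕ (suc (suc m)) (suc k)) * x ^ℚ suc k
             ≡ c * (ℕtoℚ (besselℕ (suc m) k) * x ^ℚ k) + ℕtoℚ (besselℕ m (suc k)) * x ^ℚ suc k
  term k = begin
      ℕtoℚ (besselℕ (suc (suc m)) (suc k)) * x ^ℚ suc k
    ≡⟨ cong (λ b → ℕtoℚ b * x ^ℚ suc k) (besselℕ-rec m k) ⟩
      ℕtoℚ (suc (2 ℕ.* suc m) ℕ.* besselℕ (suc m) k ℕ.+ besselℕ m (suc k)) * x ^ℚ suc k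
    ≡⟨ cong (_* x ^ℚ suc k) (trans (ℕtoℚ-+ (suc (2 ℕ.* suc m) ℕ.* besselℕ (suc m) k) (besselℕ m (suc k)))
         (cong (_+ ℕtoℚ (besselℕ m (suc k))) (ℕtoℚ-* (suc (2 ℕ.* suc m)) (besselℕ (suc m) k)))) ⟩
      (odd (suc m) * ℕtoℚ (besselℕ (suc m) k) + ℕtoℚ (besselℕ m (suc k))) * (x * x ^ℚ k)
    ≡⟨ solve 5 (λ o a b x p → (o :* a :+ b) :* (x :* p) := (o :* x) :* (a :* p) :+ b :* (x :* p)) refl
         (odd (suc m)) (ℕtoℚ (besselℕ (suc m) k)) (ℕtoℚ (besselℕ m (suc k))) x (x ^ℚ k) ⟩
      c * (ℕtoℚ (besselℕ (suc m) k) * x ^ℚ k) + ℕtoℚ (besselℕ m (suc k)) * x ^ℚ suc k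
    ∎
  beyond-degree : ∀ k → m < k → ℕtoℚ (besselℕ m k) * x ^ℚ k ≡ 0ℚ
  beyond-degree k m<k = trans (cong (λ b → ℕtoℚ b * x ^ℚ k) (besselℕ-vanishes m<k)) (ℚP.*-zeroˡ (x ^ℚ k))

yPrev-rec : ∀ x k → yPrev (suc (suc k)) x ≡ odd k * x * yPrev (suc k) x + yPrev k x
yPrev-rec x zero = begin
    y 1 x
  ≡⟨ y-monomial 1 x ⟩
    1ℚ * 1ℚ + 1ℚ * (x * 1ℚ)
  ≡⟨ solve 1 (λ x → con 1ℚ :* con 1ℚ :+ con 1ℚ :* (x :* con 1ℚ) := con 1ℚ :* x :* (con 1ℚ :* con 1ℚ) :+ con 1ℚ)
       refl x ⟩
    odd 0 * x * (1ℚ * 1ℚ) + 1ℚ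
  ≡⟨ cong (λ v → odd 0 * x * v + 1ℚ) (sym (y-monomial 0 x)) ⟩
    odd 0 * x * y 0 x + 1ℚ
  ∎
  where open ≡-Reasoning
yPrev-rec x (suc m) = begin
    y (suc (suc m)) x
  ≡⟨ y-monomial (suc (suc m)) x ⟩
    yMonomial (suc (suc m)) x
  ≡⟨ yMonomial-rec m x ⟩
    odd (suc m) * x * yMonomial (suc m) x + yMonomial m x
  ≡⟨ cong₂ (λ u v → odd (suc m) * x * u + v) (sym (y-monomial (suc m) x)) (sym (y-monomial m x)) ⟩
    odd (suc m) * x * y (suc m) x + y m x
  ∎
  where open ≡-Reasoning

-- Binomial convolution (a ⋆ b)_n = Σ_k C(n,k)·a_{n−k}·b_k: the coefficient
-- sequence of the product of the exponential generating functions of a and b.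
conv : (ℕ → ℚ) → (ℕ → ℚ) → ℕ → ℚ
conv a b n = sumTo n (λ k → ℕtoℚ (n C k) * (a (n ∸ k) * b k))

-- Index shift and Euler operator: on generating functions, d/dt and t·d/dt.
∂ : (ℕ → ℚ) → ℕ → ℚ
∂ a m = a (suc m)

θ : (ℕ → ℚ) → ℕ → ℚ
θ a m = ℕtoℚ m * a m

-- Leibniz rule for d/dt: ∂(a ⋆ b) = ∂a ⋆ b + a ⋆ ∂b, from Pascal's rule.
conv-leibniz : ∀ a b n → conv a b (suc n) ≡ conv (∂ a) b n + conv a (∂ b) n
conv-leibniz a b n = begin
    conv a b (suc n)
  ≡⟨ sumTo-shift n _ ⟩
    first + sumTo n (λ k → ℕtoℚ (suc n C suc k) * (a (n ∸ k) * b (suc k)))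
  ≡⟨ cong (λ s → first + s) (trans (sumTo-cong n (λ k _ → pascal k)) (sumTo-+ n _ _)) ⟩
    first + (conv a (∂ b) n + rest)
  ≡⟨ solve 3 (λ p q r → p :+ (q :+ r) := (p :+ r) :+ q) refl first (conv a (∂ b) n) rest ⟩
    (first + rest) + conv a (∂ b) n
  ≡⟨ cong (_+ conv a (∂ b) n) first+rest ⟩
    conv (∂ a) b n + conv a (∂ b) n
  ∎
  where
  open ≡-Reasoning
  first rest : ℚ
  first = ℕtoℚ (suc n C 0) * (a (suc n) * b 0)
  rest = sumTo n (λ k → ℕtoℚ (n C suc k) * (a (n ∸ k) * b (suc k)))
  pascal : ∀ k → ℕtoℚ (suc n C suc k) * (a (n ∸ k) * b (suc k)) ≡
           ℕtoℚ (n C k) * (a (n ∸ k) * b (suc k)) + ℕtoℚ (n C suc k) * (a (n ∸ k) * b (suc k))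
  pascal k = begin
      ℕtoℚ (suc n C suc k) * (a (n ∸ k) * b (suc k))
    ≡⟨ cong (λ c → ℕtoℚ c * (a (n ∸ k) * b (suc k))) (sym (nCk+nC[k+1]≡[n+1]C[k+1] n k)) ⟩
      ℕtoℚ ((n C k) ℕ.+ (n C suc k)) * (a (n ∸ k) * b (suc k))
    ≡⟨ cong (_* (a (n ∸ k) * b (suc k))) (ℕtoℚ-+ (n C k) (n C suc k)) ⟩
      (ℕtoℚ (n C k) + ℕtoℚ (n C suc k)) * (a (n ∸ k) * b (suc k))
    ≡⟨ ℚP.*-distribʳ-+ (a (n ∸ k) * b (suc k)) (ℕtoℚ (n C k)) (ℕtoℚ (n C suc k)) ⟩
      ℕtoℚ (n C k) * (a (n ∸ k) * b (suc k)) + ℕtoℚ (n C suc k) * (a (n ∸ k) * b (suc k))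
    ∎
  -- (∂a ⋆ b)_n, with its first term split off and its (vanishing) term k = n+1 added
  summand : ℕ → ℚ
  summand k = ℕtoℚ (n C k) * (a (suc n ∸ k) * b k)
  first+rest : first + rest ≡ conv (∂ a) b n
  first+rest = begin
      first + rest
    ≡⟨ sym (sumTo-shift n summand) ⟩
      sumTo n summand + summand (suc n)
    ≡⟨ cong₂ _+_ (sumTo-cong n (λ k k≤n → cong (λ i → ℕtoℚ (n C k) * (a i * b k)) (ℕP.+-∸-assoc 1 k≤n)))
                 (cong (λ c → ℕtoℚ c * (a (n ∸ n) * b (suc n))) (k>n⇒nCk≡0 (ℕP.n<1+n n))) ⟩
      conv (∂ a) b n + 0ℚ * (a (n ∸ n) * b (suc n))
    ≡⟨ solve 2 (λ s t → s :+ con 0ℚ :* t := s) refl (conv (∂ a) b n) (a (n ∸ n) * b (suc n)) ⟩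
      conv (∂ a) b n
    ∎

-- Leibniz rule for t·d/dt: n·(a ⋆ b)_n = (θa ⋆ b)_n + (a ⋆ θb)_n, since n = (n−k) + k.
conv-euler : ∀ a b n → ℕtoℚ n * conv a b n ≡ conv (θ a) b n + conv a (θ b) n
conv-euler a b n = trans (sym (sumTo-* n (ℕtoℚ n) _)) (trans (sumTo-cong n split) (sumTo-+ n _ _))
  where
  split : ∀ k → k ≤ n → ℕtoℚ n * (ℕtoℚ (n C k) * (a (n ∸ k) * b k)) ≡
          ℕtoℚ (n C k) * ((ℕtoℚ (n ∸ k) * a (n ∸ k)) * b k) + ℕtoℚ (n C k) * (a (n ∸ k) * (ℕtoℚ k * b k))
  split k k≤n = begin
      ℕtoℚ n * (ℕtoℚ (n C k) * (a (n ∸ k) * b k))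
    ≡⟨ cong (λ i → ℕtoℚ i * (ℕtoℚ (n C k) * (a (n ∸ k) * b k))) (sym (ℕP.m∸n+n≡m k≤n)) ⟩
      ℕtoℚ (n ∸ k ℕ.+ k) * (ℕtoℚ (n C k) * (a (n ∸ k) * b k))
    ≡⟨ cong (_* (ℕtoℚ (n C k) * (a (n ∸ k) * b k))) (ℕtoℚ-+ (n ∸ k) k) ⟩
      (ℕtoℚ (n ∸ k) + ℕtoℚ k) * (ℕtoℚ (n C k) * (a (n ∸ k) * b k))
    ≡⟨ solve 5 (λ u v c p q → (u :+ v) :* (c :* (p :* q)) := c :* ((u :* p) :* q) :+ c :* (p :* (v :* q))) refl
         (ℕtoℚ (n ∸ k)) (ℕtoℚ k) (ℕtoℚ (n C k)) (a (n ∸ k)) (b k) ⟩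
      ℕtoℚ (n C k) * ((ℕtoℚ (n ∸ k) * a (n ∸ k)) * b k) + ℕtoℚ (n C k) * (a (n ∸ k) * (ℕtoℚ k * b k))
    ∎
    where open ≡-Reasoning

-- θa ⋆ ∂b = ∂a ⋆ θb: both are the coefficients of t·A′(t)·B′(t).  Termwise this
-- is the absorption identity C(n,k)·(n−k) = C(n,k+1)·(k+1) after a shift of k;
-- the last term on the left and the first on the right vanish.
conv-θ∂-symm : ∀ a b n → conv (θ a) (∂ b) n ≡ conv (∂ a) (θ b) n
conv-θ∂-symm a b zero = solve 4 (λ p q r s → con 1ℚ :* ((con 0ℚ :* p) :* q) := con 1ℚ :* (r :* (con 0ℚ :* s))) refl
  (a 0) (b 1) (a 1) (b 0)
conv-θ∂-symm a b (suc n) = begin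
    sumTo n L + L (suc n)
  ≡⟨ cong₂ _+_ (sumTo-cong n (λ k k≤n → absorb k k≤n)) L-last ⟩
    sumTo n (λ k → R (suc k)) + 0ℚ
  ≡⟨ solve 3 (λ s t u → s :+ con 0ℚ := con 1ℚ :* (t :* (con 0ℚ :* u)) :+ s) refl
       (sumTo n (λ k → R (suc k))) (a (suc (suc n))) (b 0) ⟩
    R 0 + sumTo n (λ k → R (suc k))
  ≡⟨ sym (sumTo-shift n R) ⟩
    conv (∂ a) (θ b) (suc n)
  ∎
  where
  open ≡-Reasoning
  m : ℕ
  m = suc n
  L R : ℕ → ℚ
  L k = ℕtoℚ (m C k) * ((ℕtoℚ (m ∸ k) * a (m ∸ k)) * b (suc k))
  R k = ℕtoℚ (m C k) * (a (suc (m ∸ k)) * (ℕtoℚ k * b k))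
  absorb : ∀ k → k ≤ n → L k ≡ R (suc k)
  absorb k k≤n = begin
      ℕtoℚ (m C k) * ((ℕtoℚ (m ∸ k) * a (m ∸ k)) * B)
    ≡⟨ cong (λ i → ℕtoℚ (m C k) * ((ℕtoℚ (m ∸ k) * a i) * B)) (ℕP.+-∸-assoc 1 k≤n) ⟩
      ℕtoℚ (m C k) * ((ℕtoℚ (m ∸ k) * A) * B)
    ≡⟨ solve 4 (λ c d p q → c :* ((d :* p) :* q) := (c :* d) :* (p :* q)) refl (ℕtoℚ (m C k)) (ℕtoℚ (m ∸ k)) A B ⟩
      (ℕtoℚ (m C k) * ℕtoℚ (m ∸ k)) * (A * B)
    ≡⟨ cong (_* (A * B)) (trans (sym (ℕtoℚ-* (m C k) (m ∸ k)))
                         (trans (cong ℕtoℚ (binom-absorb m k)) (ℕtoℚ-* (m C suc k) (suc k)))) ⟩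
      (ℕtoℚ (m C suc k) * ℕtoℚ (suc k)) * (A * B)
    ≡⟨ solve 4 (λ c d p q → (c :* d) :* (p :* q) := c :* (p :* (d :* q))) refl (ℕtoℚ (m C suc k)) (ℕtoℚ (suc k)) A B ⟩
      R (suc k)
    ∎
    where
    A B : ℚ
    A = a (suc (n ∸ k))
    B = b (suc k)
  L-last : L m ≡ 0ℚ
  L-last = trans (cong (λ i → ℕtoℚ (m C m) * ((ℕtoℚ i * a i) * b (suc m))) (ℕP.n∸n≡0 m))
    (solve 3 (λ c p q → c :* ((con 0ℚ :* p) :* q) := con 0ℚ) refl (ℕtoℚ (m C m)) (a 0) (b (suc m)))

conv-linearˡ : ∀ {a a₁ a₂ : ℕ → ℚ} (b : ℕ → ℚ) p q n → (∀ m → a m ≡ p * a₁ m + q * a₂ m) →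
               conv a b n ≡ p * conv a₁ b n + q * conv a₂ b n
conv-linearˡ {a} {a₁} {a₂} b p q n a≗ = begin
    conv a b n
  ≡⟨ sumTo-cong n (λ k _ → distribute k) ⟩
    sumTo n (λ k → p * T₁ k + q * T₂ k)
  ≡⟨ trans (sumTo-+ n _ _) (cong₂ _+_ (sumTo-* n p T₁) (sumTo-* n q T₂)) ⟩
    p * conv a₁ b n + q * conv a₂ b n
  ∎
  where
  open ≡-Reasoning
  T₁ T₂ : ℕ → ℚ
  T₁ k = ℕtoℚ (n C k) * (a₁ (n ∸ k) * b k)
  T₂ k = ℕtoℚ (n C k) * (a₂ (n ∸ k) * b k)
  distribute : ∀ k → ℕtoℚ (n C k) * (a (n ∸ k) * b k) ≡ p * T₁ k + q * T₂ k
  distribute k = trans (cong (λ v → ℕtoℚ (n C k) * (v * b k)) (a≗ (n ∸ k)))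
    (solve 6 (λ c p q u v w → c :* ((p :* u :+ q :* v) :* w) := p :* (c :* (u :* w)) :+ q :* (c :* (v :* w))) refl
       (ℕtoℚ (n C k)) p q (a₁ (n ∸ k)) (a₂ (n ∸ k)) (b k))

conv-linearʳ : ∀ (a : ℕ → ℚ) {b b₁ b₂ : ℕ → ℚ} p q n → (∀ k → b k ≡ p * b₁ k + q * b₂ k) →
               conv a b n ≡ p * conv a b₁ n + q * conv a b₂ n
conv-linearʳ a {b} {b₁} {b₂} p q n b≗ = begin
    conv a b n
  ≡⟨ sumTo-cong n (λ k _ → distribute k) ⟩
    sumTo n (λ k → p * T₁ k + q * T₂ k)
  ≡⟨ trans (sumTo-+ n _ _) (cong₂ _+_ (sumTo-* n p T₁) (sumTo-* n q T₂)) ⟩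
    p * conv a b₁ n + q * conv a b₂ n
  ∎
  where
  open ≡-Reasoning
  T₁ T₂ : ℕ → ℚ
  T₁ k = ℕtoℚ (n C k) * (a (n ∸ k) * b₁ k)
  T₂ k = ℕtoℚ (n C k) * (a (n ∸ k) * b₂ k)
  distribute : ∀ k → ℕtoℚ (n C k) * (a (n ∸ k) * b k) ≡ p * T₁ k + q * T₂ k
  distribute k = trans (cong (λ v → ℕtoℚ (n C k) * (a (n ∸ k) * v)) (b≗ k))
    (solve 6 (λ c p q u v w → c :* (w :* (p :* u :+ q :* v)) := p :* (c :* (w :* u)) :+ q :* (c :* (w :* v))) refl
       (ℕtoℚ (n C k)) p q (b₁ k) (b₂ k) (a (n ∸ k)))

odd-split : ∀ m → odd m ≡ 1ℚ + ℕtoℚ 2 * ℕtoℚ m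
odd-split m = trans (ℕtoℚ-+ 1 (2 ℕ.* m)) (cong (1ℚ +_) (ℕtoℚ-* 2 m))

-- With generating functions G, F, H = GF:
-- (1−2xt)G′ = xG and (1−2xt)F″ = xF′ + F give (1−2xt)H″ = 3xH′ + H.
conv-rec : ∀ x (g f : ℕ → ℚ) →
  (∀ m → g (suc m) ≡ odd m * x * g m) →
  (∀ k → f (suc (suc k)) ≡ odd k * x * f (suc k) + f k) →
  ∀ n → conv g f (suc (suc n)) ≡ odd (suc n) * x * conv g f (suc n) + conv g f n
conv-rec x g f g-rec f-rec n = trans expand-lhs (sym expand-rhs)
  where
  open ≡-Reasoning
  two three ñ : ℚ
  two = ℕtoℚ 2
  three = ℕtoℚ 3
  ñ = ℕtoℚ n
  -- (1−2xt)G′ = xG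
  ∂g : ∀ m → ∂ g m ≡ x * g m + (two * x) * θ g m
  ∂g m = trans (g-rec m) (trans (cong (λ o → o * x * g m) (odd-split m))
    (solve 3 (λ x a G → (con 1ℚ :+ con two :* a) :* x :* G := x :* G :+ (con two :* x) :* (a :* G)) refl x (ℕtoℚ m) (g m)))
  -- (1−2xt)G″ = 3xG′, the derivative of the previous equation
  ∂∂g : ∀ m → ∂ (∂ g) m ≡ (three * x) * ∂ g m + (two * x) * θ (∂ g) m
  ∂∂g m = trans (∂g (suc m)) (trans (cong (λ c → x * g (suc m) + (two * x) * (c * g (suc m))) (ℕtoℚ-+ 1 m))
    (solve 3 (λ x a G → x :* G :+ (con two :* x) :* ((con 1ℚ :+ a) :* G) := (con three :* x) :* G :+ (con two :* x) :* (a :* G))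
       refl x (ℕtoℚ m) (g (suc m))))
  -- (1−2xt)F″ = xF′ + F
  ∂∂f : ∀ k → ∂ (∂ f) k ≡ x * (1ℚ * ∂ f k + two * θ (∂ f) k) + 1ℚ * f k
  ∂∂f k = trans (f-rec k) (trans (cong (λ o → o * x * f (suc k) + f k) (odd-split k))
    (solve 4 (λ x a F₁ F₀ → (con 1ℚ :+ con two :* a) :* x :* F₁ :+ F₀
                           := x :* (con 1ℚ :* F₁ :+ con two :* (a :* F₁)) :+ con 1ℚ :* F₀)
       refl x (ℕtoℚ k) (f (suc k)) (f k)))
  A₁ A₂ A₃ A₄ A₅ h : ℚ
  A₁ = conv (∂ g) f n
  A₂ = conv (θ (∂ g)) f n
  A₃ = conv g (∂ f) n
  A₄ = conv (θ g) (∂ f) n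
  A₅ = conv g (θ (∂ f)) n
  h = conv g f n
  -- h_{n+2} = (∂∂g ⋆ f)_n + 2·(∂g ⋆ ∂f)_n + (g ⋆ ∂∂f)_n, each piece expanded
  -- by the equations above
  P Q R : ℚ
  P = (three * x) * A₁ + (two * x) * A₂
  Q = x * A₃ + (two * x) * A₄
  R = x * (1ℚ * A₃ + two * A₅) + 1ℚ * h
  expand-lhs : conv g f (suc (suc n)) ≡ (P + Q) + (Q + R)
  expand-lhs = begin
      conv g f (suc (suc n))
    ≡⟨ conv-leibniz g f (suc n) ⟩
      conv (∂ g) f (suc n) + conv g (∂ f) (suc n)
    ≡⟨ cong₂ _+_ (conv-leibniz (∂ g) f n) (conv-leibniz g (∂ f) n) ⟩
      (conv (∂ (∂ g)) f n + conv (∂ g) (∂ f) n) + (conv (∂ g) (∂ f) n + conv g (∂ (∂ f)) n)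
    ≡⟨ cong₂ (λ u v → (u + v) + (v + conv g (∂ (∂ f)) n))
         (conv-linearˡ f (three * x) (two * x) n ∂∂g) (conv-linearˡ (∂ f) x (two * x) n ∂g) ⟩
      (P + Q) + (Q + conv g (∂ (∂ f)) n)
    ≡⟨ cong (λ w → (P + Q) + (Q + w))
         (trans (conv-linearʳ g x 1ℚ n ∂∂f) (cong (λ u → x * u + 1ℚ * h) (conv-linearʳ g 1ℚ two n (λ _ → refl)))) ⟩
      (P + Q) + (Q + R)
    ∎
  ñA₁ : ñ * A₁ ≡ A₂ + A₄
  ñA₁ = trans (conv-euler (∂ g) f n) (cong (A₂ +_) (sym (conv-θ∂-symm g f n)))
  ñA₃ : ñ * A₃ ≡ A₄ + A₅
  ñA₃ = conv-euler g (∂ f) n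
  expand-rhs : odd (suc n) * x * conv g f (suc n) + h ≡ (P + Q) + (Q + R)
  expand-rhs = begin
      odd (suc n) * x * conv g f (suc n) + h
    ≡⟨ cong₂ (λ o c → o * x * c + h) (trans (odd-split (suc n)) (cong (λ c → 1ℚ + two * c) (ℕtoℚ-+ 1 n)))
                                      (conv-leibniz g f n) ⟩
      (1ℚ + two * (1ℚ + ñ)) * x * (A₁ + A₃) + h
    ≡⟨ solve 5 (λ x n a₁ a₃ h → (con 1ℚ :+ con two :* (con 1ℚ :+ n)) :* x :* (a₁ :+ a₃) :+ h
                 := (con three :* x) :* a₁ :+ (con three :* x) :* a₃
                    :+ (con two :* x) :* (n :* a₁) :+ (con two :* x) :* (n :* a₃) :+ h)
         refl x ñ A₁ A₃ h ⟩
      (three * x) * A₁ + (three * x) * A₃ + (two * x) * (ñ * A₁) + (two * x) * (ñ * A₃) + h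
    ≡⟨ cong₂ (λ u v → (three * x) * A₁ + (three * x) * A₃ + (two * x) * u + (two * x) * v + h) ñA₁ ñA₃ ⟩
      (three * x) * A₁ + (three * x) * A₃ + (two * x) * (A₂ + A₄) + (two * x) * (A₄ + A₅) + h
    ≡⟨ solve 7 (λ x a₁ a₂ a₃ a₄ a₅ h →
           (con three :* x) :* a₁ :+ (con three :* x) :* a₃ :+ (con two :* x) :* (a₂ :+ a₄) :+ (con two :* x) :* (a₄ :+ a₅) :+ h
        := (((con three :* x) :* a₁ :+ (con two :* x) :* a₂) :+ (x :* a₃ :+ (con two :* x) :* a₄))
           :+ ((x :* a₃ :+ (con two :* x) :* a₄) :+ (x :* (con 1ℚ :* a₃ :+ con two :* a₅) :+ con 1ℚ :* h)))
         refl x A₁ A₂ A₃ A₄ A₅ h ⟩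
      (P + Q) + (Q + R)
    ∎

recurrence-unique : ∀ (c : ℕ → ℚ) {u v : ℕ → ℚ} →
  (∀ n → u (suc (suc n)) ≡ c n * u (suc n) + u n) →
  (∀ n → v (suc (suc n)) ≡ c n * v (suc n) + v n) →
  u 0 ≡ v 0 → u 1 ≡ v 1 → ∀ n → u n ≡ v n
recurrence-unique c {u} {v} u-rec v-rec u₀≡v₀ u₁≡v₁ n = proj₁ (agree n)
  where
  agree : ∀ n → u n ≡ v n × u (suc n) ≡ v (suc n)
  agree zero    = u₀≡v₀ , u₁≡v₁
  agree (suc n) = let (uₙ≡vₙ , uₙ₊₁≡vₙ₊₁) = agree n in
    uₙ₊₁≡vₙ₊₁ ,
    trans (u-rec n) (trans (cong₂ (λ p q → c n * p + q) uₙ₊₁≡vₙ₊₁ uₙ≡vₙ) (sym (v-rec n)))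

-- g_m = (2m−1)!!·x^m, the coefficients of (1−2xt)^{−1/2} = Σ g_m t^m/m!.
oddPowers : ℚ → ℕ → ℚ
oddPowers x m = ℕtoℚ (dfact m) * x ^ℚ m

-- g_{m+1} = (2m+1)·x·g_m, i.e. (1−2xt)G′ = xG
oddPowers-rec : ∀ x m → oddPowers x (suc m) ≡ odd m * x * oddPowers x m
oddPowers-rec x m = trans (cong (_* (x * x ^ℚ m)) (ℕtoℚ-* (suc (2 ℕ.* m)) (dfact m)))
  (solve 4 (λ o d x p → (o :* d) :* (x :* p) := o :* x :* (d :* p)) refl (odd m) (ℕtoℚ (dfact m)) x (x ^ℚ m))

-- The convolution of (2m−1)!!·x^m with y_{k−1}(x) is y_n(x): both sides obey the
-- Bessel recurrence in n; at n = 0 both are 1, and at n = 1 both are x + 1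
-- (the latter by y_1(x) = x·y_0(x) + 1 and y_0(x) = 1, which holds by computation).
convolution-identity : ∀ x n → conv (oddPowers x) (λ k → yPrev k x) n ≡ y n x
convolution-identity x = recurrence-unique (λ n → odd (suc n) * x)
  (conv-rec x (oddPowers x) (λ k → yPrev k x) (oddPowers-rec x) (yPrev-rec x))
  (λ n → yPrev-rec x (suc n))
  refl
  (trans (solve 1 (λ x → con 1ℚ :* ((con 1ℚ :* (x :* con 1ℚ)) :* con 1ℚ) :+ con 1ℚ :* ((con 1ℚ :* con 1ℚ) :* con 1ℚ)
                       := con 1ℚ :* x :* con 1ℚ :+ con 1ℚ) refl x)
         (sym (yPrev-rec x 0)))

corollary1 : (n : ℕ) (x : ℚ) →
    y n x ≡ sumTo n (λ k → ℕtoℚ (dfact (n ∸ k) Data.Nat.* (n C k)) * (yPrev k x * (x ^ℚ (n ∸ k))))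
corollary1 n x = trans (sym (convolution-identity x n)) (sumTo-cong n (λ k _ → reorder k))
  where
  reorder : ∀ k → ℕtoℚ (n C k) * (oddPowers x (n ∸ k) * yPrev k x)
                ≡ ℕtoℚ (dfact (n ∸ k) ℕ.* (n C k)) * (yPrev k x * x ^ℚ (n ∸ k))
  reorder k = trans
    (solve 4 (λ c d p f → c :* ((d :* p) :* f) := (d :* c) :* (f :* p)) refl
       (ℕtoℚ (n C k)) (ℕtoℚ (dfact (n ∸ k))) (x ^ℚ (n ∸ k)) (yPrev k x))
    (cong (_* (yPrev k x * x ^ℚ (n ∸ k))) (sym (ℕtoℚ-* (dfact (n ∸ k)) (n C k))))
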